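{- For positive integers $n,s$ let $$S_6(n,s)=\sum_{m=1}^{n}\sum_{q=1}^{\min(m,s)}\binom{s}{q}2^{q-1}\binom{m-1}{q-1},\qquad S_7(n,s)=\sum_{m=1}^{n}\sum_{q=1}^{\min(m,s)}\binom{s}{q}2^{q-1}\binom{ -1+m/2}{q-1}',$$ and $S(n,s)=-\frac12+\sum_{q=0}^{s}2^{q-1}\binom{s}{q}\binom{n}{q}$. Then $$S_6(n,s)=-\frac12+\frac12[y^n]\big((1+2y)^s(1+y)^n\big)=-\frac12+\frac12[z^n]\big((1+z)^s(1-z)^{ -s-1}\big),$$ $S_6(n,s)=S(n,s)$, and $S_7(n,s)=S(\lfloor n/2\rfloor,s)$.
   Context: $[y^n]F(y)$ denotes the coefficient of $y^n$ in the power series $F$. For real $p$ and integer $q$, $\binom{p}{q}'$ denotes $\binom{p}{q}$ if $p,q$ are nonnegative integers and $0$ otherwise; $\binom{n}{q}=0$ for $q>n$. -}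

module Defs where

open import Data.Nat as ℕ using (ℕ; zero; suc; _⊓_)
open import Data.Nat.Combinatorics using (_C_)
open import Data.Integer as ℤ using (ℤ; +_; -[1+_])
open import Data.Rational as ℚ using (ℚ; 0ℚ; 1ℚ; ½; _+_; _*_; _/_)
open import Data.List using (List; []; _∷_)

fromℕ : ℕ → ℚ
fromℕ k = + k / 1

Σ< : ℕ → (ℕ → ℚ) → ℚ
Σ< zero    f = 0ℚ
Σ< (suc n) f = Σ< n f + f n

-- Σ_{i=lo}^{hi} f i  (empty, i.e. 0, if hi < lo)
ΣFromTo : ℕ → ℕ → (ℕ → ℚ) → ℚ
ΣFromTo lo hi f = Σ< (suc hi ℕ.∸ lo) (λ i → f (lo ℕ.+ i))

twoNeg : ℕ → ℚ
twoNeg zero    = ½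
twoNeg (suc k) = ½ * twoNeg k

two^ : ℤ → ℚ
two^ (+ k)      = fromℕ (2 ℕ.^ k)
two^ -[1+ k ]   = twoNeg k

-- binom(p, q)' : binom(p,q) if p, q nonnegative integers, 0 otherwise
binom′ : ℚ → ℤ → ℚ
binom′ p -[1+ _ ] = 0ℚ
binom′ p (+ k) with ℚ.denominator-1 p | ℚ.numerator p
... | zero  | + a      = fromℕ (a C k)
... | zero  | -[1+ _ ] = 0ℚ
... | suc _ | _        = 0ℚ

Series : Set
Series = ℕ → ℚ

coeff : ℕ → Series → ℚ
coeff n F = F n

-- polynomial from its coefficient list (lowest degree first)
poly : List ℚ → Series
poly []       n       = 0ℚ
poly (a ∷ as) zero    = a
poly (a ∷ as) (suc n) = poly as n

oneS : Series
oneS = poly (1ℚ ∷ [])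

_⊛_ : Series → Series → Series
(F ⊛ G) n = Σ< (suc n) (λ k → F k * G (n ℕ.∸ k))

infixl 7 _⊛_

_^ˢ_ : Series → ℕ → Series
F ^ˢ zero    = oneS
F ^ˢ suc k   = F ⊛ (F ^ˢ k)

-- (1 - z)^{-1} = Σ_k z^k, the multiplicative inverse of 1 - z
invOneMinus : Series
invOneMinus _ = 1ℚ

S6 : ℕ → ℕ → ℚ
S6 n s = ΣFromTo 1 n (λ m → ΣFromTo 1 (m ⊓ s) (λ q →
           fromℕ (s C q) * two^ (+ q ℤ.- + 1) * fromℕ ((m ℕ.∸ 1) C (q ℕ.∸ 1))))

S7 : ℕ → ℕ → ℚ
S7 n s = ΣFromTo 1 n (λ m → ΣFromTo 1 (m ⊓ s) (λ q →
           fromℕ (s C q) * two^ (+ q ℤ.- + 1)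
             * binom′ (ℚ.- 1ℚ + (+ m / 2)) (+ q ℤ.- + 1)))

S : ℕ → ℕ → ℚ
S n s = ℚ.- ½ + ΣFromTo 0 s (λ q → two^ (+ q ℤ.- + 1) * fromℕ (s C q) * fromℕ (n C q))

genA : ℕ → ℕ → Series
genA n s = (poly (1ℚ ∷ fromℕ 2 ∷ []) ^ˢ s) ⊛ (poly (1ℚ ∷ 1ℚ ∷ []) ^ˢ n)

genB : ℕ → Series
genB s = (poly (1ℚ ∷ 1ℚ ∷ []) ^ˢ s) ⊛ (invOneMinus ^ˢ suc s)

module Submission where

-- All four identities reduce to the Delannoy number
--   D n s = Σ_{k=0}^{n} 2^k (s C k) (n C k).
-- Write R m s = Σ_{q=1}^{s} (s C q) 2^(q-1) (m C (q-1)) for the inner sum of S6 at the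
-- outer index m + 1.  Pascal's rule in n gives D (m+1) s = D m s + 2 R m s, hence
-- D n s = 1 + 2 S6 n s.  Splitting off the k = 0 term of D gives D n s = 1 + 2 (S n s + 1/2),
-- so S6 = S = -1/2 + D/2.  The binomial theorem shows that D n s is the n-th coefficient of
-- (1 + 2y)^s (1 + y)^n.  Pascal's rule in s gives D n (s+1) = D n s + 2 Σ_{m<n} D m s, which
-- is the effect on coefficients of multiplying (1 + z)^s (1 - z)^(-s-1) by (1 + z)/(1 - z);
-- so D n s is also the n-th coefficient of that series.  Finally the binomial
-- (m/2 - 1 C q - 1)' of S7 vanishes for odd m, where m/2 - 1 is not an integer, and equals
-- ((m-2)/2 C q - 1) for even m, so S7 keeps only the summands of S6 at the outer indices
-- m/2, and S7 n s = S6 ⌊n/2⌋ s.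

module Sums where
  open import Data.Nat
  open import Data.Nat.Properties
  open import Algebra.Properties.CommutativeSemigroup +-commutativeSemigroup using (interchange)
  open import Data.Sum using (inj₁; inj₂)
  open import Relation.Binary.PropositionalEquality
  open ≡-Reasoning

  σ : ℕ → (ℕ → ℕ) → ℕ
  σ zero    f = 0
  σ (suc n) f = σ n f + f n

  σ-cong : ∀ n {f g : ℕ → ℕ} → (∀ i → i < n → f i ≡ g i) → σ n f ≡ σ n g
  σ-cong zero    f≡g = refl
  σ-cong (suc n) f≡g = cong₂ _+_ (σ-cong n (λ i i<n → f≡g i (m<n⇒m<1+n i<n))) (f≡g n (n<1+n n))

  σ-congᶠ : ∀ n {f g : ℕ → ℕ} → f ≗ g → σ n f ≡ σ n g
  σ-congᶠ n f≗g = σ-cong n (λ i _ → f≗g i)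

  σ-zero : ∀ n {f : ℕ → ℕ} → (∀ i → i < n → f i ≡ 0) → σ n f ≡ 0
  σ-zero zero    f≡0 = refl
  σ-zero (suc n) f≡0 = cong₂ _+_ (σ-zero n (λ i i<n → f≡0 i (m<n⇒m<1+n i<n))) (f≡0 n (n<1+n n))

  σ-+ : ∀ n (f g : ℕ → ℕ) → σ n (λ i → f i + g i) ≡ σ n f + σ n g
  σ-+ zero    f g = refl
  σ-+ (suc n) f g = trans (cong (_+ (f n + g n)) (σ-+ n f g)) (interchange (σ n f) (σ n g) (f n) (g n))

  σ-*ˡ : ∀ n c (f : ℕ → ℕ) → σ n (λ i → c * f i) ≡ c * σ n f
  σ-*ˡ zero    c f = sym (*-zeroʳ c)
  σ-*ˡ (suc n) c f = trans (cong (_+ c * f n) (σ-*ˡ n c f)) (sym (*-distribˡ-+ c (σ n f) (f n)))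

  σ-shift : ∀ n (f : ℕ → ℕ) → σ (suc n) f ≡ f 0 + σ n (λ i → f (suc i))
  σ-shift zero    f = sym (+-identityʳ (f 0))
  σ-shift (suc n) f = trans (cong (_+ f (suc n)) (σ-shift n f)) (+-assoc (f 0) _ _)

  σ-extend : ∀ {k L} (f : ℕ → ℕ) → (∀ i → k ≤ i → f i ≡ 0) → k ≤′ L → σ L f ≡ σ k f
  σ-extend f f≡0 (≤′-reflexive refl) = refl
  σ-extend f f≡0 (≤′-step {L} k≤′L) =
    trans (cong₂ _+_ (σ-extend f f≡0 k≤′L) (f≡0 L (≤′⇒≤ k≤′L))) (+-identityʳ _)

  σ-bounds : ∀ a b (f : ℕ → ℕ) → (∀ i → a ≤ i → f i ≡ 0) → (∀ i → b ≤ i → f i ≡ 0) → σ a f ≡ σ b f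
  σ-bounds a b f fa fb with ≤-total a b
  ... | inj₁ a≤b = sym (σ-extend f fa (≤⇒≤′ a≤b))
  ... | inj₂ b≤a = σ-extend f fb (≤⇒≤′ b≤a)

  σ-⊓ : ∀ b s (f : ℕ → ℕ) → (∀ i → b ≤ i → f i ≡ 0) → σ (b ⊓ s) f ≡ σ s f
  σ-⊓ b s f f≡0 with ≤-total b s
  ... | inj₁ b≤s = trans (cong (λ k → σ k f) (m≤n⇒m⊓n≡m b≤s)) (sym (σ-extend f f≡0 (≤⇒≤′ b≤s)))
  ... | inj₂ s≤b = cong (λ k → σ k f) (m≥n⇒m⊓n≡n s≤b)

  σ-reverse : ∀ n (f : ℕ → ℕ) → σ (suc n) f ≡ σ (suc n) (λ k → f (n ∸ k))
  σ-reverse zero    f = refl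
  σ-reverse (suc n) f = begin
      σ (suc (suc n)) f
    ≡⟨ σ-shift (suc n) f ⟩
      f 0 + σ (suc n) (λ i → f (suc i))
    ≡⟨ cong (f 0 +_) (σ-reverse n (λ i → f (suc i))) ⟩
      f 0 + σ (suc n) (λ k → f (suc (n ∸ k)))
    ≡⟨ +-comm (f 0) _ ⟩
      σ (suc n) (λ k → f (suc (n ∸ k))) + f 0
    ≡⟨ cong₂ _+_ (σ-cong (suc n) (λ k k≤n → cong f (sym (+-∸-assoc 1 (≤-pred k≤n)))))
                 (cong f (sym (n∸n≡0 n))) ⟩
      σ (suc (suc n)) (λ k → f (suc n ∸ k))
    ∎

  σ-triangle : ∀ N (F : ℕ → ℕ → ℕ) →
    σ N (λ i → σ (suc i) (F i)) ≡ σ N (λ j → σ (N ∸ j) (λ t → F (j + t) j))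
  σ-triangle zero    F = refl
  σ-triangle (suc N) F = begin
      σ N (λ i → σ (suc i) (F i)) + (σ N (F N) + F N N)
    ≡⟨ cong (_+ (σ N (F N) + F N N)) (σ-triangle N F) ⟩
      R + (σ N (F N) + F N N)
    ≡⟨ sym (+-assoc R _ _) ⟩
      (R + σ N (F N)) + F N N
    ≡⟨ cong₂ _+_ (sym (σ-+ N _ (F N))) (cong (λ x → F x N) (sym (+-identityʳ N))) ⟩
      σ N (λ j → σ (N ∸ j) (λ t → F (j + t) j) + F N j) + F (N + 0) N
    ≡⟨ cong₂ _+_ (σ-cong N (λ j j<N → sym (grow j (<⇒≤ j<N)))) (sym last) ⟩
      σ (suc N) (λ j → σ (suc N ∸ j) (λ t → F (j + t) j))
    ∎
    where
    R = σ N (λ j → σ (N ∸ j) (λ t → F (j + t) j))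
    grow : ∀ j → j ≤ N → σ (suc N ∸ j) (λ t → F (j + t) j) ≡ σ (N ∸ j) (λ t → F (j + t) j) + F N j
    grow j j≤N rewrite +-∸-assoc 1 j≤N = cong (σ (N ∸ j) (λ t → F (j + t) j) +_) (cong (λ x → F x j) (m+[n∸m]≡n j≤N))
    last : σ (suc N ∸ N) (λ t → F (N + t) N) ≡ F (N + 0) N
    last rewrite +-∸-assoc 1 (≤-refl {N}) | n∸n≡0 N = refl

module Convolution where
  open import Data.Nat
  open import Data.Nat.Properties
  open import Data.Nat.Combinatorics using (_C_; nCk+nC[k+1]≡[n+1]C[k+1])
  open import Data.Nat.Tactic.RingSolver using (solve-∀)
  open import Relation.Binary.PropositionalEquality
  open ≡-Reasoning
  open Sums

  conv : (ℕ → ℕ) → (ℕ → ℕ) → ℕ → ℕ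
  conv f g n = σ (suc n) (λ k → f k * g (n ∸ k))

  conv-cong : ∀ {f f′ g g′ : ℕ → ℕ} → f ≗ f′ → g ≗ g′ → conv f g ≗ conv f′ g′
  conv-cong f≗f′ g≗g′ n = σ-congᶠ (suc n) (λ k → cong₂ _*_ (f≗f′ k) (g≗g′ (n ∸ k)))

  conv-comm : ∀ f g → conv f g ≗ conv g f
  conv-comm f g n = trans (σ-reverse n _) (σ-cong (suc n) λ k k≤n →
    trans (cong (f (n ∸ k) *_) (cong g (m∸[m∸n]≡n (≤-pred k≤n)))) (*-comm (f (n ∸ k)) (g k)))

  conv-assoc : ∀ f g h → conv (conv f g) h ≗ conv f (conv g h)
  conv-assoc f g h n = begin
      σ (suc n) (λ i → conv f g i * h (n ∸ i))
    ≡⟨ σ-congᶠ (suc n) (λ i → σ-*ʳ (suc i) (h (n ∸ i)) _) ⟩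
      σ (suc n) (λ i → σ (suc i) (λ j → f j * g (i ∸ j) * h (n ∸ i)))
    ≡⟨ σ-triangle (suc n) (λ i j → f j * g (i ∸ j) * h (n ∸ i)) ⟩
      σ (suc n) (λ j → σ (suc n ∸ j) (λ t → f j * g (j + t ∸ j) * h (n ∸ (j + t))))
    ≡⟨ σ-cong (suc n) (λ j j≤n → column j (≤-pred j≤n)) ⟩
      σ (suc n) (λ j → f j * conv g h (n ∸ j))
    ∎
    where
    σ-*ʳ : ∀ m c (u : ℕ → ℕ) → σ m u * c ≡ σ m (λ i → u i * c)
    σ-*ʳ m c u = trans (*-comm (σ m u) c) (trans (sym (σ-*ˡ m c u)) (σ-congᶠ m (λ i → *-comm c (u i))))
    column : ∀ j → j ≤ n →
      σ (suc n ∸ j) (λ t → f j * g (j + t ∸ j) * h (n ∸ (j + t))) ≡ f j * conv g h (n ∸ j)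
    column j j≤n rewrite +-∸-assoc 1 j≤n =
      trans (σ-congᶠ (suc (n ∸ j)) (λ t →
              trans (cong₂ (λ a b → f j * g a * h b) (m+n∸m≡n j t) (sym (∸-+-assoc n j t)))
                    (*-assoc (f j) _ _)))
            (σ-*ˡ (suc (n ∸ j)) (f j) _)

  conv-regroup : ∀ a b c d → conv (conv a b) (conv c d) ≗ conv a (conv c (conv b d))
  conv-regroup a b c d n = begin
      conv (conv a b) (conv c d) n
    ≡⟨ conv-assoc a b (conv c d) n ⟩
      conv a (conv b (conv c d)) n
    ≡⟨ conv-cong {a} {a} {conv b (conv c d)} {conv c (conv b d)} (λ _ → refl) inner n ⟩
      conv a (conv c (conv b d)) n
    ∎
    where
    inner : conv b (conv c d) ≗ conv c (conv b d)
    inner k = begin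
        conv b (conv c d) k     ≡⟨ conv-assoc b c d k ⟨
        conv (conv b c) d k     ≡⟨ conv-cong {g = d} {g′ = d} (conv-comm b c) (λ _ → refl) k ⟩
        conv (conv c b) d k     ≡⟨ conv-assoc c b d k ⟩
        conv c (conv b d) k     ∎

  -- The series 1, 1 + a·z and 1/(1 - z) = 1 + z + z² + ⋯, and powers.
  one : ℕ → ℕ
  one zero    = 1
  one (suc _) = 0

  lin : ℕ → ℕ → ℕ
  lin a zero          = 1
  lin a (suc zero)    = a
  lin a (suc (suc _)) = 0

  geom : ℕ → ℕ
  geom _ = 1

  pow : (ℕ → ℕ) → ℕ → ℕ → ℕ
  pow f zero    = one
  pow f (suc k) = conv f (pow f k)

  conv-oneʳ : ∀ f → conv f one ≗ f
  conv-oneʳ f n = begin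
      σ n (λ k → f k * one (n ∸ k)) + f n * one (n ∸ n)
    ≡⟨ cong₂ _+_ (σ-zero n (λ k k<n → vanish k (m<n⇒0<n∸m k<n))) (cong (λ x → f n * one x) (n∸n≡0 n)) ⟩
      f n * 1
    ≡⟨ *-identityʳ (f n) ⟩
      f n
    ∎
    where
    vanish : ∀ k {m} → 0 < m → f k * one m ≡ 0
    vanish k {suc m} _ = *-zeroʳ (f k)

  conv-oneˡ : ∀ f → conv one f ≗ f
  conv-oneˡ f n = trans (conv-comm one f n) (conv-oneʳ f n)

  conv-lin-zero : ∀ a P → conv (lin a) P 0 ≡ P 0
  conv-lin-zero a P = +-identityʳ (P 0)

  conv-lin-suc : ∀ a P k → conv (lin a) P (suc k) ≡ P (suc k) + a * P k
  conv-lin-suc a P k = begin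
      conv (lin a) P (suc k)
    ≡⟨ σ-shift (suc k) _ ⟩
      1 * P (suc k) + σ (suc k) (λ i → lin a (suc i) * P (k ∸ i))
    ≡⟨ cong (1 * P (suc k) +_) (σ-shift k _) ⟩
      1 * P (suc k) + (a * P k + σ k (λ i → 0))
    ≡⟨ cong₂ _+_ (*-identityˡ (P (suc k))) (trans (cong (a * P k +_) (σ-zero k (λ _ _ → refl))) (+-identityʳ _)) ⟩
      P (suc k) + a * P k
    ∎

  conv-geom : ∀ P n → conv geom P n ≡ σ (suc n) P
  conv-geom P n = trans (conv-comm geom P n) (σ-congᶠ (suc n) (λ k → *-identityʳ (P k)))

  pow-lin : ∀ a s k → pow (lin a) s k ≡ (s C k) * a ^ k
  pow-lin a zero    zero    = refl
  pow-lin a zero    (suc k) = refl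
  pow-lin a (suc s) zero    = trans (conv-lin-zero a (pow (lin a) s)) (pow-lin a s zero)
  pow-lin a (suc s) (suc k) = begin
      conv (lin a) (pow (lin a) s) (suc k)
    ≡⟨ conv-lin-suc a (pow (lin a) s) k ⟩
      pow (lin a) s (suc k) + a * pow (lin a) s k
    ≡⟨ cong₂ (λ x y → x + a * y) (pow-lin a s (suc k)) (pow-lin a s k) ⟩
      (s C suc k) * (a * a ^ k) + a * ((s C k) * a ^ k)
    ≡⟨ regroup (s C k) (s C suc k) a (a ^ k) ⟩
      ((s C k) + (s C suc k)) * (a * a ^ k)
    ≡⟨ cong (_* (a * a ^ k)) (nCk+nC[k+1]≡[n+1]C[k+1] s k) ⟩
      (suc s C suc k) * a ^ suc k
    ∎
    where
    regroup : ∀ x y a p → y * (a * p) + a * (x * p) ≡ (x + y) * (a * p)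
    regroup = solve-∀

  -- Multiplying by (1 + z)/(1 - z) = 1 + 2z + 2z² + ⋯.
  conv-ratio : ∀ P n → conv (lin 1) (conv geom P) n ≡ P n + 2 * σ n P
  conv-ratio P zero    = trans (conv-lin-zero 1 (conv geom P)) (trans (conv-geom P 0) (sym (+-identityʳ (P 0))))
  conv-ratio P (suc k) = begin
      conv (lin 1) (conv geom P) (suc k)
    ≡⟨ conv-lin-suc 1 (conv geom P) k ⟩
      conv geom P (suc k) + 1 * conv geom P k
    ≡⟨ cong₂ (λ x y → x + 1 * y) (conv-geom P (suc k)) (conv-geom P k) ⟩
      (σ (suc k) P + P (suc k)) + 1 * σ (suc k) P
    ≡⟨ rearrange (σ (suc k) P) (P (suc k)) ⟩
      P (suc k) + 2 * σ (suc k) P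
    ∎
    where
    rearrange : ∀ x p → (x + p) + 1 * x ≡ p + 2 * x
    rearrange = solve-∀

module Delannoy where
  open import Data.Nat
  open import Data.Nat.Properties
  open import Data.Nat.Combinatorics using (_C_; k>n⇒nCk≡0; nCk≡nC[n∸k]; nCk+nC[k+1]≡[n+1]C[k+1])
  open import Data.Nat.Tactic.RingSolver using (solve-∀)
  open import Relation.Binary.PropositionalEquality
  open ≡-Reasoning
  open Sums
  open Convolution

  δ : ℕ → ℕ → ℕ → ℕ
  δ n s k = 2 ^ k * (s C k) * (n C k)

  D : ℕ → ℕ → ℕ
  D n s = σ (suc n) (δ n s)

  -- R m s = Σ_{q=1}^{s} (s C q) 2^(q-1) (m C (q-1)), the inner sum of S6 at the outer
  -- index m + 1; ρ m s t is its summand at q = t + 1.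
  ρ : ℕ → ℕ → ℕ → ℕ
  ρ m s t = (s C suc t) * 2 ^ t * (m C t)

  R : ℕ → ℕ → ℕ
  R m s = σ s (ρ m s)

  δ-vanish-n : ∀ n s k → n < k → δ n s k ≡ 0
  δ-vanish-n n s k n<k rewrite k>n⇒nCk≡0 n<k = *-zeroʳ (2 ^ k * (s C k))

  δ-vanish-s : ∀ n s k → s < k → δ n s k ≡ 0
  δ-vanish-s n s k s<k rewrite k>n⇒nCk≡0 s<k | *-zeroʳ (2 ^ k) = refl

  ρ-vanish-m : ∀ m s t → m < t → ρ m s t ≡ 0
  ρ-vanish-m m s t m<t rewrite k>n⇒nCk≡0 m<t = *-zeroʳ ((s C suc t) * 2 ^ t)

  ρ-vanish-s : ∀ m s t → s ≤ t → ρ m s t ≡ 0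
  ρ-vanish-s m s t s≤t rewrite k>n⇒nCk≡0 (s≤s s≤t) = refl

  D-split : ∀ n s → D n s ≡ 1 + σ n (λ t → δ n s (suc t))
  D-split n s = σ-shift n (δ n s)

  -- D n s = 1 + 2 Σ_{q=1}^{s} 2^(q-1) (s C q) (n C q): the form in which D appears in S.
  D-closed : ∀ n s → D n s ≡ 1 + 2 * σ s (λ t → 2 ^ t * (s C suc t) * (n C suc t))
  D-closed n s = begin
      D n s
    ≡⟨ D-split n s ⟩
      1 + σ n (λ t → δ n s (suc t))
    ≡⟨ cong (1 +_) (σ-bounds n s _ (λ t n≤t → δ-vanish-n n s (suc t) (s≤s n≤t))
                                   (λ t s≤t → δ-vanish-s n s (suc t) (s≤s s≤t))) ⟩
      1 + σ s (λ t → δ n s (suc t))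
    ≡⟨ cong (1 +_) (trans (σ-congᶠ s (λ t → double (2 ^ t) (s C suc t) (n C suc t))) (σ-*ˡ s 2 _)) ⟩
      1 + 2 * σ s (λ t → 2 ^ t * (s C suc t) * (n C suc t))
    ∎
    where
    double : ∀ p x y → 2 * p * x * y ≡ 2 * (p * x * y)
    double = solve-∀

  -- Pascal's rule in n: D (m + 1) s - D m s = 2 R m s.
  D-step-n : ∀ m s → D (suc m) s ≡ D m s + 2 * R m s
  D-step-n m s = begin
      D (suc m) s
    ≡⟨ D-split (suc m) s ⟩
      1 + σ (suc m) (λ t → δ (suc m) s (suc t))
    ≡⟨ cong (1 +_) (trans (σ-congᶠ (suc m) pascal) (σ-+ (suc m) _ _)) ⟩
      1 + (σ (suc m) (λ t → δ m s (suc t)) + σ (suc m) (λ t → 2 * ρ m s t))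
    ≡⟨ sym (+-assoc 1 (σ (suc m) (λ t → δ m s (suc t))) (σ (suc m) (λ t → 2 * ρ m s t))) ⟩
      (1 + σ (suc m) (λ t → δ m s (suc t))) + σ (suc m) (λ t → 2 * ρ m s t)
    ≡⟨ cong₂ _+_ (cong (1 +_) (σ-extend _ (λ t m≤t → δ-vanish-n m s (suc t) (s≤s m≤t)) (≤′-step (≤′-reflexive refl))))
                 (σ-*ˡ (suc m) 2 (ρ m s)) ⟩
      (1 + σ m (λ t → δ m s (suc t))) + 2 * σ (suc m) (ρ m s)
    ≡⟨ cong₂ (λ x y → x + 2 * y) (sym (D-split m s))
                                 (σ-bounds (suc m) s (ρ m s) (ρ-vanish-m m s) (ρ-vanish-s m s)) ⟩
      D m s + 2 * R m s
    ∎
    where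
    split : ∀ p x y z → 2 * p * x * (y + z) ≡ 2 * p * x * z + 2 * (x * p * y)
    split = solve-∀
    pascal : ∀ t → δ (suc m) s (suc t) ≡ δ m s (suc t) + 2 * ρ m s t
    pascal t rewrite sym (nCk+nC[k+1]≡[n+1]C[k+1] m t) = split (2 ^ t) (s C suc t) (m C t) (m C suc t)

  -- Summing D-step-n: D n s = 1 + 2 Σ_{m<n} R m s; this is the identity behind S6.
  D-partial : ∀ n s → D n s ≡ 1 + 2 * σ n (λ m → R m s)
  D-partial zero    s = refl
  D-partial (suc n) s = begin
      D (suc n) s                         ≡⟨ D-step-n n s ⟩
      D n s + 2 * R n s                   ≡⟨ cong (_+ 2 * R n s) (D-partial n s) ⟩
      1 + 2 * σ n (λ m → R m s) + 2 * R n s ≡⟨ regroup (σ n (λ m → R m s)) (R n s) ⟩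
      1 + 2 * σ (suc n) (λ m → R m s)     ∎
    where
    regroup : ∀ x y → 1 + 2 * x + 2 * y ≡ 1 + 2 * (x + y)
    regroup = solve-∀

  D-zero : ∀ n → D n 0 ≡ 1
  D-zero n = trans (D-partial n 0) (cong (λ x → 1 + 2 * x) (σ-zero n (λ _ _ → refl)))

  -- Pascal's rule in s: R m (s + 1) - R m s = D m s.
  R-step-s : ∀ m s → R m (suc s) ≡ R m s + D m s
  R-step-s m s = begin
      σ (suc s) (ρ m (suc s))
    ≡⟨ trans (σ-congᶠ (suc s) pascal) (σ-+ (suc s) _ _) ⟩
      σ (suc s) (ρ m s) + σ (suc s) (δ m s)
    ≡⟨ cong₂ _+_ (σ-extend (ρ m s) (ρ-vanish-s m s) (≤′-step (≤′-reflexive refl)))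
                 (σ-bounds (suc s) (suc m) (δ m s) (λ k s<k → δ-vanish-s m s k s<k) (λ k m<k → δ-vanish-n m s k m<k)) ⟩
      R m s + D m s
    ∎
    where
    split : ∀ p x y z → (x + y) * p * z ≡ y * p * z + p * x * z
    split = solve-∀
    pascal : ∀ t → ρ m (suc s) t ≡ ρ m s t + δ m s t
    pascal t rewrite sym (nCk+nC[k+1]≡[n+1]C[k+1] s t) = split (2 ^ t) (s C t) (s C suc t) (m C t)

  -- Combining both rules: D n (s + 1) = D n s + 2 Σ_{m<n} D m s.
  D-step-s : ∀ n s → D n (suc s) ≡ D n s + 2 * σ n (λ m → D m s)
  D-step-s n s = begin
      D n (suc s)
    ≡⟨ D-partial n (suc s) ⟩
      1 + 2 * σ n (λ m → R m (suc s))
    ≡⟨ cong (λ x → 1 + 2 * x) (trans (σ-congᶠ n (λ m → R-step-s m s)) (σ-+ n _ _)) ⟩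
      1 + 2 * (σ n (λ m → R m s) + σ n (λ m → D m s))
    ≡⟨ regroup (σ n (λ m → R m s)) (σ n (λ m → D m s)) ⟩
      (1 + 2 * σ n (λ m → R m s)) + 2 * σ n (λ m → D m s)
    ≡⟨ cong (_+ 2 * σ n (λ m → D m s)) (sym (D-partial n s)) ⟩
      D n s + 2 * σ n (λ m → D m s)
    ∎
    where
    regroup : ∀ x y → 1 + 2 * (x + y) ≡ (1 + 2 * x) + 2 * y
    regroup = solve-∀

  D-coeff-A : ∀ n s → conv (pow (lin 2) s) (pow (lin 1) n) n ≡ D n s
  D-coeff-A n s = σ-cong (suc n) λ k k≤n → begin
      pow (lin 2) s k * pow (lin 1) n (n ∸ k)
    ≡⟨ cong₂ _*_ (pow-lin 2 s k) (pow-lin 1 n (n ∸ k)) ⟩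
      (s C k) * 2 ^ k * ((n C (n ∸ k)) * 1 ^ (n ∸ k))
    ≡⟨ cong₂ (λ a b → (s C k) * 2 ^ k * (a * b)) (sym (nCk≡nC[n∸k] (≤-pred k≤n))) (^-zeroˡ (n ∸ k)) ⟩
      (s C k) * 2 ^ k * ((n C k) * 1)
    ≡⟨ reorder (s C k) (2 ^ k) (n C k) ⟩
      δ n s k
    ∎
    where
    reorder : ∀ x p y → x * p * (y * 1) ≡ p * x * y
    reorder = solve-∀

  -- D n s is the coefficient of z^n in (1 + z)^s / (1 - z)^(s+1): both sides satisfy
  -- D-step-s, because multiplying by (1 + z)/(1 - z) is the step s ↦ s + 1.
  D-coeff-B : ∀ s n → conv (pow (lin 1) s) (pow geom (suc s)) n ≡ D n s
  D-coeff-B zero    n = trans (conv-oneˡ (conv geom one) n) (trans (conv-oneʳ geom n) (sym (D-zero n)))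
  D-coeff-B (suc s) n = begin
      conv (conv (lin 1) U) (conv geom V) n
    ≡⟨ conv-regroup (lin 1) U geom V n ⟩
      conv (lin 1) (conv geom (conv U V)) n
    ≡⟨ conv-ratio (conv U V) n ⟩
      conv U V n + 2 * σ n (conv U V)
    ≡⟨ cong₂ (λ x y → x + 2 * y) (D-coeff-B s n) (σ-congᶠ n (D-coeff-B s)) ⟩
      D n s + 2 * σ n (λ m → D m s)
    ≡⟨ sym (D-step-s n s) ⟩
      D n (suc s)
    ∎
    where
    U = pow (lin 1) s
    V = pow geom (suc s)

open import Defs
open import Data.Nat as ℕ using (ℕ; zero; suc; _≤_; _⊓_; ⌊_/2⌋)
import Data.Nat.Properties as ℕₚ
open import Data.Nat.Combinatorics using (_C_)
open import Data.Integer as ℤ using (ℤ; +_; -[1+_])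
import Data.Integer.Properties as ℤₚ
open import Data.Rational as ℚ using (ℚ; mkℚ; 0ℚ; 1ℚ; ½; _+_; _*_; _/_; -_)
import Data.Rational.Properties as ℚₚ
import Data.Rational.Unnormalised as ℚᵘ
import Data.Rational.Unnormalised.Properties as ℚᵘₚ
import Data.Nat.Coprimality as Coprimality
open import Data.Empty using (⊥-elim)
open import Data.List using (_∷_; [])
open import Data.Product using (_×_; _,_)
open import Function using (_∘_)
open import Relation.Binary.PropositionalEquality
open ≡-Reasoning
open Sums
open Convolution
open Delannoy

-- fromℕ is a semiring homomorphism ℕ → ℚ; it is checked on unnormalised fractions.
toℚᵘ-fromℕ : ∀ k → ℚ.toℚᵘ (fromℕ k) ℚᵘ.≃ ℚᵘ.mkℚᵘ (+ k) 0
toℚᵘ-fromℕ k = ℚₚ.toℚᵘ-fromℚᵘ (ℚᵘ.mkℚᵘ (+ k) 0)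

fromℕ-+ : ∀ a b → fromℕ (a ℕ.+ b) ≡ fromℕ a + fromℕ b
fromℕ-+ a b = ℚₚ.toℚᵘ-injective (ℚᵘₚ.≃-trans (toℚᵘ-fromℕ (a ℕ.+ b)) (ℚᵘₚ.≃-trans sum
  (ℚᵘₚ.≃-sym (ℚᵘₚ.≃-trans (ℚₚ.toℚᵘ-homo-+ (fromℕ a) (fromℕ b)) (ℚᵘₚ.+-cong (toℚᵘ-fromℕ a) (toℚᵘ-fromℕ b))))))
  where
  sum : ℚᵘ.mkℚᵘ (+ (a ℕ.+ b)) 0 ℚᵘ.≃ ℚᵘ.mkℚᵘ (+ a) 0 ℚᵘ.+ ℚᵘ.mkℚᵘ (+ b) 0
  sum = ℚᵘ.*≡* (trans (ℤₚ.*-identityʳ _) (trans (ℤₚ.pos-+ a b)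
          (sym (trans (ℤₚ.*-identityʳ _) (cong₂ ℤ._+_ (ℤₚ.*-identityʳ (+ a)) (ℤₚ.*-identityʳ (+ b)))))))

fromℕ-* : ∀ a b → fromℕ (a ℕ.* b) ≡ fromℕ a * fromℕ b
fromℕ-* a b = ℚₚ.toℚᵘ-injective (ℚᵘₚ.≃-trans (toℚᵘ-fromℕ (a ℕ.* b)) (ℚᵘₚ.≃-trans product
  (ℚᵘₚ.≃-sym (ℚᵘₚ.≃-trans (ℚₚ.toℚᵘ-homo-* (fromℕ a) (fromℕ b)) (ℚᵘₚ.*-cong (toℚᵘ-fromℕ a) (toℚᵘ-fromℕ b))))))
  where
  product : ℚᵘ.mkℚᵘ (+ (a ℕ.* b)) 0 ℚᵘ.≃ ℚᵘ.mkℚᵘ (+ a) 0 ℚᵘ.* ℚᵘ.mkℚᵘ (+ b) 0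
  product = ℚᵘ.*≡* (cong (ℤ._* + 1) (ℤₚ.pos-* a b))

Σ<-cong : ∀ n {f g : ℕ → ℚ} → f ≗ g → Σ< n f ≡ Σ< n g
Σ<-cong zero    f≗g = refl
Σ<-cong (suc n) f≗g = cong₂ _+_ (Σ<-cong n f≗g) (f≗g n)

Σ<-zero : ∀ n → Σ< n (λ _ → 0ℚ) ≡ 0ℚ
Σ<-zero zero    = refl
Σ<-zero (suc n) = cong (_+ 0ℚ) (Σ<-zero n)

Σ<-shift : ∀ n (f : ℕ → ℚ) → Σ< (suc n) f ≡ f 0 + Σ< n (λ i → f (suc i))
Σ<-shift zero    f = trans (ℚₚ.+-identityˡ (f 0)) (sym (ℚₚ.+-identityʳ (f 0)))
Σ<-shift (suc n) f = trans (cong (_+ f (suc n)) (Σ<-shift n f)) (ℚₚ.+-assoc (f 0) _ _)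

Σ<-fromℕ : ∀ n (f : ℕ → ℕ) → Σ< n (fromℕ ∘ f) ≡ fromℕ (σ n f)
Σ<-fromℕ zero    f = refl
Σ<-fromℕ (suc n) f = trans (cong (_+ fromℕ (f n)) (Σ<-fromℕ n f)) (sym (fromℕ-+ (σ n f) (f n)))

Σ<-fromℕ³ : ∀ n (a b c : ℕ → ℕ) →
  Σ< n (λ t → fromℕ (a t) * fromℕ (b t) * fromℕ (c t)) ≡ fromℕ (σ n (λ t → a t ℕ.* b t ℕ.* c t))
Σ<-fromℕ³ n a b c = trans (Σ<-cong n (λ t → begin
    fromℕ (a t) * fromℕ (b t) * fromℕ (c t)  ≡⟨ cong (_* fromℕ (c t)) (fromℕ-* (a t) (b t)) ⟨
    fromℕ (a t ℕ.* b t) * fromℕ (c t)        ≡⟨ fromℕ-* (a t ℕ.* b t) (c t) ⟨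
    fromℕ (a t ℕ.* b t ℕ.* c t)              ∎))
  (Σ<-fromℕ n (λ t → a t ℕ.* b t ℕ.* c t))

data Halving : ℕ → ℕ → Set where
  even : ∀ j → Halving (j ℕ.+ j) j
  odd  : ∀ j → Halving (suc (j ℕ.+ j)) j

halving : ∀ n → Halving n ⌊ n /2⌋
halving zero          = even 0
halving (suc zero)    = odd 0
halving (suc (suc n)) with ⌊ n /2⌋ | halving n
... | _ | even j = subst (λ k → Halving (suc k) (suc j)) (ℕₚ.+-suc j j) (even (suc j))
... | _ | odd j  = subst (λ k → Halving (suc (suc k)) (suc j)) (ℕₚ.+-suc j j) (odd (suc j))

-- Keeping only the odd-indexed terms: if f (2j) = 0 and f (2j + 1) = g j, then
-- Σ_{i<n} f i = Σ_{j<⌊n/2⌋} g j.  This is how S7 collapses to S6 at ⌊n/2⌋.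
module _ (f g : ℕ → ℚ) (f-even : ∀ j → f (j ℕ.+ j) ≡ 0ℚ) (f-odd : ∀ j → f (suc (j ℕ.+ j)) ≡ g j) where

  Σ<-to-even : ∀ j → Σ< (j ℕ.+ j) f ≡ Σ< j g
  Σ<-to-odd  : ∀ j → Σ< (suc (j ℕ.+ j)) f ≡ Σ< j g

  Σ<-to-even zero    = refl
  Σ<-to-even (suc j) = begin
      Σ< (suc j ℕ.+ suc j) f                    ≡⟨ cong (λ k → Σ< (suc k) f) (ℕₚ.+-suc j j) ⟩
      Σ< (suc (j ℕ.+ j)) f + f (suc (j ℕ.+ j))  ≡⟨ cong₂ _+_ (Σ<-to-odd j) (f-odd j) ⟩
      Σ< j g + g j                              ∎

  Σ<-to-odd j = trans (cong₂ _+_ (Σ<-to-even j) (f-even j)) (ℚₚ.+-identityʳ _)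

  Σ<-odd-terms : ∀ n → Σ< n f ≡ Σ< ⌊ n /2⌋ g
  Σ<-odd-terms n with ⌊ n /2⌋ | halving n
  ... | _ | even j = Σ<-to-even j
  ... | _ | odd j  = Σ<-to-odd j

⊛-fromℕ : ∀ {F G : Series} {f g : ℕ → ℕ} → F ≗ fromℕ ∘ f → G ≗ fromℕ ∘ g → F ⊛ G ≗ fromℕ ∘ conv f g
⊛-fromℕ {F} {G} {f} {g} F≗f G≗g n = trans
  (Σ<-cong (suc n) (λ k → trans (cong₂ _*_ (F≗f k) (G≗g (n ℕ.∸ k))) (sym (fromℕ-* (f k) (g (n ℕ.∸ k))))))
  (Σ<-fromℕ (suc n) (λ k → f k ℕ.* g (n ℕ.∸ k)))

^ˢ-fromℕ : ∀ {F : Series} {f : ℕ → ℕ} → F ≗ fromℕ ∘ f → ∀ s → F ^ˢ s ≗ fromℕ ∘ pow f s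
^ˢ-fromℕ         F≗f zero    zero    = refl
^ˢ-fromℕ         F≗f zero    (suc k) = refl
^ˢ-fromℕ {f = f} F≗f (suc s)         = ⊛-fromℕ {f = f} {g = pow f s} F≗f (^ˢ-fromℕ F≗f s)

linear-fromℕ : ∀ a → poly (1ℚ ∷ fromℕ a ∷ []) ≗ fromℕ ∘ lin a
linear-fromℕ a zero          = refl
linear-fromℕ a (suc zero)    = refl
linear-fromℕ a (suc (suc k)) = refl

coeff-genA : ∀ n s → coeff n (genA n s) ≡ fromℕ (D n s)
coeff-genA n s = trans (⊛-fromℕ {f = pow (lin 2) s} {g = pow (lin 1) n}
                              (^ˢ-fromℕ (linear-fromℕ 2) s) (^ˢ-fromℕ (linear-fromℕ 1) n) n)
                       (cong fromℕ (D-coeff-A n s))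

coeff-genB : ∀ n s → coeff n (genB s) ≡ fromℕ (D n s)
coeff-genB n s = trans (⊛-fromℕ {f = pow (lin 1) s} {g = pow geom (suc s)}
                              (^ˢ-fromℕ (linear-fromℕ 1) s) (^ˢ-fromℕ {f = geom} (λ _ → refl) (suc s)) n)
                       (cong fromℕ (D-coeff-B s n))

cancel-½ : ∀ y → - ½ + (½ + y) ≡ y
cancel-½ y = trans (sym (ℚₚ.+-assoc (- ½) ½ y)) (trans (cong (_+ y) (ℚₚ.+-inverseˡ ½)) (ℚₚ.+-identityˡ y))

centre-odd : ∀ {a} x → a ≡ 1 ℕ.+ 2 ℕ.* x → - ½ + ½ * fromℕ a ≡ fromℕ x
centre-odd {a} x refl = begin
    - ½ + ½ * fromℕ (1 ℕ.+ 2 ℕ.* x)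
  ≡⟨ cong (λ y → - ½ + ½ * y) (trans (fromℕ-+ 1 (2 ℕ.* x)) (cong (λ y → 1ℚ + y) (fromℕ-* 2 x))) ⟩
    - ½ + ½ * (1ℚ + fromℕ 2 * fromℕ x)
  ≡⟨ cong (λ y → - ½ + y) (ℚₚ.*-distribˡ-+ ½ 1ℚ (fromℕ 2 * fromℕ x)) ⟩
    - ½ + (½ + ½ * (fromℕ 2 * fromℕ x))
  ≡⟨ cong (λ y → - ½ + (½ + y)) (trans (sym (ℚₚ.*-assoc ½ (fromℕ 2) (fromℕ x))) (ℚₚ.*-identityˡ (fromℕ x))) ⟩
    - ½ + (½ + fromℕ x)
  ≡⟨ cancel-½ (fromℕ x) ⟩
    fromℕ x
  ∎

-- An inner sum of S6 (or S7) in which the binomial (i C t) cuts the range t < s at b > i.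
inner-sum : ∀ b i s → i ℕ.< b →
  Σ< (b ⊓ s) (λ t → fromℕ (s C suc t) * fromℕ (2 ℕ.^ t) * fromℕ (i C t)) ≡ fromℕ (R i s)
inner-sum b i s i<b = trans (Σ<-fromℕ³ (b ⊓ s) (λ t → s C suc t) (2 ℕ.^_) (i C_))
  (cong fromℕ (σ-⊓ b s (ρ i s) (λ t b≤t → ρ-vanish-m i s t (ℕₚ.<-≤-trans i<b b≤t))))

-- The summand of S6 at the outer index m = i + 1.
S6-summand : ℕ → ℕ → ℚ
S6-summand s i = Σ< (suc i ⊓ s) (λ t → fromℕ (s C suc t) * two^ (+ suc t ℤ.- + 1) * fromℕ (i C t))

-- S6 = -1/2 + D/2, since D n s = 1 + 2 Σ_{m<n} R m s.
S6-centre : ∀ n s → S6 n s ≡ - ½ + ½ * fromℕ (D n s)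
S6-centre n s = begin
    Σ< n (S6-summand s)                  ≡⟨ Σ<-cong n (λ i → inner-sum (suc i) i s ℕₚ.≤-refl) ⟩
    Σ< n (λ i → fromℕ (R i s))           ≡⟨ Σ<-fromℕ n (λ i → R i s) ⟩
    fromℕ (σ n (λ i → R i s))            ≡⟨ centre-odd (σ n (λ i → R i s)) (D-partial n s) ⟨
    - ½ + ½ * fromℕ (D n s)              ∎

-- S = -1/2 + D/2: its q = 0 term is 1/2, and the rest is half of D n s - 1.
S-centre : ∀ n s → S n s ≡ - ½ + ½ * fromℕ (D n s)
S-centre n s = begin
    S n s
  ≡⟨ cong (λ y → - ½ + y) (Σ<-shift s _) ⟩
    - ½ + (½ + Σ< s (λ t → fromℕ (2 ℕ.^ t) * fromℕ (s C suc t) * fromℕ (n C suc t)))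
  ≡⟨ cancel-½ _ ⟩
    Σ< s (λ t → fromℕ (2 ℕ.^ t) * fromℕ (s C suc t) * fromℕ (n C suc t))
  ≡⟨ Σ<-fromℕ³ s (2 ℕ.^_) (λ t → s C suc t) (λ t → n C suc t) ⟩
    fromℕ (σ s (λ t → 2 ℕ.^ t ℕ.* (s C suc t) ℕ.* (n C suc t)))
  ≡⟨ centre-odd (σ s (λ t → 2 ℕ.^ t ℕ.* (s C suc t) ℕ.* (n C suc t))) (D-closed n s) ⟨
    - ½ + ½ * fromℕ (D n s)
  ∎

binom′-nonintegral : ∀ p k → ℚ.denominator-1 p ≢ 0 → binom′ p k ≡ 0ℚ
binom′-nonintegral p -[1+ k ] _ = refl
binom′-nonintegral p (+ k) d≢0 with ℚ.denominator-1 p | ℚ.numerator p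
... | zero  | _ = ⊥-elim (d≢0 refl)
... | suc _ | _ = refl

binom′-fromℕ : ∀ j t → binom′ (fromℕ j) (+ t) ≡ fromℕ (j C t)
binom′-fromℕ j t rewrite ℚₚ.normalize-coprime (Coprimality.sym (Coprimality.1-coprimeTo j)) = refl

j+j≡2*j : ∀ j → j ℕ.+ j ≡ 2 ℕ.* j
j+j≡2*j j = cong (j ℕ.+_) (sym (ℕₚ.+-identityʳ j))

-- The upper argument of binom′ in S7 is m/2 - 1; it is the integer j when m = 2j + 2, …
half-minus-one-even : ∀ j → - 1ℚ + (+ suc (suc (j ℕ.+ j)) / 2) ≡ fromℕ j
half-minus-one-even j = ℚₚ.toℚᵘ-injective (ℚᵘₚ.≃-trans (ℚₚ.toℚᵘ-homo-+ (- 1ℚ) (+ suc (suc (j ℕ.+ j)) / 2))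
  (ℚᵘₚ.≃-trans (ℚᵘₚ.+-congʳ (ℚᵘ.mkℚᵘ -[1+ 0 ] 0) (ℚₚ.toℚᵘ-fromℚᵘ (ℚᵘ.mkℚᵘ (+ suc (suc (j ℕ.+ j))) 1)))
  (ℚᵘₚ.≃-trans difference (ℚᵘₚ.≃-sym (toℚᵘ-fromℕ j)))))
  where
  difference : ℚᵘ.mkℚᵘ -[1+ 0 ] 0 ℚᵘ.+ ℚᵘ.mkℚᵘ (+ suc (suc (j ℕ.+ j))) 1 ℚᵘ.≃ ℚᵘ.mkℚᵘ (+ j) 0
  difference = ℚᵘ.*≡* (trans (ℤₚ.*-identityʳ _)
    (trans (cong +_ (trans (ℕₚ.*-identityʳ (j ℕ.+ j)) (trans (j+j≡2*j j) (ℕₚ.*-comm 2 j)))) (ℤₚ.pos-* j 2)))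

-- … while for m = 2j + 1 it is not an integer, because twice an integer is even.
integer-not-half-odd : ∀ p j → ℚ.denominator-1 p ≡ 0 → p + 1ℚ ≢ + suc (j ℕ.+ j) / 2
integer-not-half-odd p@(mkℚ a _ _) j refl eq = ℕₚ.even≢odd ℤ.∣ b ∣ j parity
  where
  b : ℤ
  b = a ℤ.* + 1 ℤ.+ + 1
  doubled : b ℤ.* + 2 ≡ + suc (j ℕ.+ j) ℤ.* + 1
  doubled with ℚᵘₚ.≃-trans (ℚᵘₚ.≃-sym (ℚₚ.toℚᵘ-homo-+ p 1ℚ))
                 (ℚᵘₚ.≃-trans (ℚₚ.toℚᵘ-cong eq) (ℚₚ.toℚᵘ-fromℚᵘ (ℚᵘ.mkℚᵘ (+ suc (j ℕ.+ j)) 1)))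
  ... | ℚᵘ.*≡* e = e
  parity : 2 ℕ.* ℤ.∣ b ∣ ≡ suc (2 ℕ.* j)
  parity = begin
    2 ℕ.* ℤ.∣ b ∣                   ≡⟨ ℕₚ.*-comm 2 ℤ.∣ b ∣ ⟩
    ℤ.∣ b ∣ ℕ.* 2                   ≡⟨ ℤₚ.abs-* b (+ 2) ⟨
    ℤ.∣ b ℤ.* + 2 ∣                 ≡⟨ cong ℤ.∣_∣ (trans doubled (ℤₚ.*-identityʳ (+ suc (j ℕ.+ j)))) ⟩
    suc (j ℕ.+ j)                   ≡⟨ cong suc (j+j≡2*j j) ⟩
    suc (2 ℕ.* j)                   ∎

minus-one-plus-one : ∀ x → (- 1ℚ + x) + 1ℚ ≡ x
minus-one-plus-one x = begin
  (- 1ℚ + x) + 1ℚ     ≡⟨ ℚₚ.+-comm (- 1ℚ + x) 1ℚ ⟩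
  1ℚ + (- 1ℚ + x)     ≡⟨ ℚₚ.+-assoc 1ℚ (- 1ℚ) x ⟨
  (1ℚ + - 1ℚ) + x     ≡⟨ cong (_+ x) (ℚₚ.+-inverseʳ 1ℚ) ⟩
  0ℚ + x              ≡⟨ ℚₚ.+-identityˡ x ⟩
  x                   ∎

half-minus-one-odd : ∀ j → ℚ.denominator-1 (- 1ℚ + (+ suc (j ℕ.+ j) / 2)) ≢ 0
half-minus-one-odd j integral =
  integer-not-half-odd (- 1ℚ + (+ suc (j ℕ.+ j) / 2)) j integral (minus-one-plus-one (+ suc (j ℕ.+ j) / 2))

-- The summand of S7 at the outer index m = i + 1.  For m = 2j + 1 it vanishes; for
-- m = 2j + 2 it is the summand of S6 at the outer index j + 1.
S7-summand : ℕ → ℕ → ℚ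
S7-summand s i = Σ< (suc i ⊓ s) (λ t →
  fromℕ (s C suc t) * two^ (+ suc t ℤ.- + 1) * binom′ (- 1ℚ + (+ suc i / 2)) (+ suc t ℤ.- + 1))

S7-summand-vanishes : ∀ s j → S7-summand s (j ℕ.+ j) ≡ 0ℚ
S7-summand-vanishes s j = trans
  (Σ<-cong (suc (j ℕ.+ j) ⊓ s) (λ t → trans
    (cong (fromℕ (s C suc t) * fromℕ (2 ℕ.^ t) *_)
          (binom′-nonintegral (- 1ℚ + (+ suc (j ℕ.+ j) / 2)) (+ t) (half-minus-one-odd j)))
    (ℚₚ.*-zeroʳ (fromℕ (s C suc t) * fromℕ (2 ℕ.^ t)))))
  (Σ<-zero (suc (j ℕ.+ j) ⊓ s))

S7-summand-is-S6 : ∀ s j → S7-summand s (suc (j ℕ.+ j)) ≡ S6-summand s j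
S7-summand-is-S6 s j = begin
    S7-summand s (suc (j ℕ.+ j))
  ≡⟨ Σ<-cong (suc (suc (j ℕ.+ j)) ⊓ s) (λ t → cong (fromℕ (s C suc t) * fromℕ (2 ℕ.^ t) *_)
       (trans (cong (λ p → binom′ p (+ t)) (half-minus-one-even j)) (binom′-fromℕ j t))) ⟩
    Σ< (suc (suc (j ℕ.+ j)) ⊓ s) (λ t → fromℕ (s C suc t) * fromℕ (2 ℕ.^ t) * fromℕ (j C t))
  ≡⟨ inner-sum (suc (suc (j ℕ.+ j))) j s (ℕ.s≤s (ℕₚ.m≤n⇒m≤1+n (ℕₚ.m≤m+n j j))) ⟩
    fromℕ (R j s)
  ≡⟨ inner-sum (suc j) j s ℕₚ.≤-refl ⟨
    S6-summand s j
  ∎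

S7-halves : ∀ n s → S7 n s ≡ S6 ⌊ n /2⌋ s
S7-halves n s = Σ<-odd-terms (S7-summand s) (S6-summand s) (S7-summand-vanishes s) (S7-summand-is-S6 s) n

lemma5 : (n s : ℕ) → 1 ≤ n → 1 ≤ s →
    (S6 n s ≡ - ½ + ½ * coeff n (genA n s))
    × (S6 n s ≡ - ½ + ½ * coeff n (genB s))
    × (S6 n s ≡ S n s)
    × (S7 n s ≡ S ⌊ n /2⌋ s)
lemma5 n s _ _ =
    trans (S6-centre n s) (cong centred (sym (coeff-genA n s)))
  , trans (S6-centre n s) (cong centred (sym (coeff-genB n s)))
  , trans (S6-centre n s) (sym (S-centre n s))
  , trans (S7-halves n s) (trans (S6-centre ⌊ n /2⌋ s) (sym (S-centre ⌊ n /2⌋ s)))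
  where
  centred : ℚ → ℚ
  centred c = - ½ + ½ * c
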